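{- For any two finite simple undirected graphs $G_1=(V_1,E_1)$ and $G_2=(V_2,E_2)$, the lexicographic product $G_1[G_2]$ satisfies \[\operatorname{nlcw}(G_1[G_2]) = \max(\operatorname{nlcw}(G_1),\operatorname{nlcw}(G_2))\quad\text{and}\quad \operatorname{cw}(G_1[G_2]) = \max(\operatorname{cw}(G_1),\operatorname{cw}(G_2)).\]
   Context: Lexicographic product: $G_1[G_2]$ has vertex set $V_1\times V_2$, and $(u_1,u_2)$, $(v_1,v_2)$ are adjacent iff $\{u_1,v_1\}\in E_1$, or ($u_1=v_1$ and $\{u_2,v_2\}\in E_2$). Clique-width: for a positive integer $k$, $\mathrm{CW}_k$ is the smallest class of graphs whose vertices carry labels from $\{1,\dots,k\}$ that contains every single-vertex graph with any label $a\in\{1,\dots,k\}$ and is closed under: disjoint union $G\oplus J$ of two vertex-disjoint labeled graphs (labels kept); relabeling $\rho_{a\to b}$ for $a\neq b$ (every vertex labeled $a$ gets label $b$); and $\eta_{a,b}$ for $a\neq b$ (add all edges between a vertex labeled $a$ and a vertex labeled $b$). The clique-width $\operatorname{cw}(G)$ of a graph is the least $k$ such that some labeling of $G$ lies in $\mathrm{CW}_k$. NLC-width: $\mathrm{NLC}_k$ is the smallest class of labeled graphs (labels in $\{1,\dots,k\}$) that contains every single-vertex graph with any label and is closed under: $G\times_S J$ for $S\subseteq\{1,\dots,k\}^2$ (disjoint union of vertex-disjoint $G$ and $J$, plus all edges $\{u,v\}$ with $u\in V_G$, $v\in V_J$ and $(\mathrm{lab}(u),\mathrm{lab}(v))\in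 S$); and $\circ_R$ for a function $R:\{1,\dots,k\}\to\{1,\dots,k\}$ (each label $a$ replaced by $R(a)$). The NLC-width $\operatorname{nlcw}(G)$ is the least $k$ such that some labeling of $G$ lies in $\mathrm{NLC}_k$. -}

module Defs where

open import Data.Nat using (ℕ; suc; _+_; _*_; _≤_)
open import Data.Fin using (Fin; splitAt; remQuot; _≟_)
open import Data.Bool using (Bool; true; false; _∧_; _∨_)
open import Data.Sum using (_⊎_; inj₁; inj₂)
open import Data.Product using (_×_; _,_; Σ; ∃)
open import Relation.Nullary using (¬_)
open import Relation.Nullary.Decidable using (⌊_⌋)
open import Relation.Binary.PropositionalEquality using (_≡_; _≢_)
open import Function.Bundles using (_↔_; Inverse)

record Graph : Set where
  field
    n   : ℕ
    adj : Fin n → Fin n → Bool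
open Graph public

IsSimple : Graph → Set
IsSimple G = (∀ i j → adj G i j ≡ adj G j i) × (∀ i → adj G i i ≡ false)

_==_ : ∀ {m} → Fin m → Fin m → Bool
a == b = ⌊ a ≟ b ⌋

lex : Graph → Graph → Graph
lex G₁ G₂ = record { n = n G₁ * n G₂ ; adj = λ x y → go (remQuot (n G₂) x) (remQuot (n G₂) y) }
  where
  go : Fin (n G₁) × Fin (n G₂) → Fin (n G₁) × Fin (n G₂) → Bool
  go (u₁ , u₂) (v₁ , v₂) = adj G₁ u₁ v₁ ∨ ((u₁ == v₁) ∧ adj G₂ u₂ v₂)

_≅_ : Graph → Graph → Set
G ≅ H = Σ (Fin (n G) ↔ Fin (n H)) λ f →
          ∀ i j → adj H (Inverse.to f i) (Inverse.to f j) ≡ adj G i j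

data CWExp (k : ℕ) : Set where
  vert : Fin k → CWExp k
  _⊕_  : CWExp k → CWExp k → CWExp k
  ρ    : (a b : Fin k) → a ≢ b → CWExp k → CWExp k
  η    : (a b : Fin k) → a ≢ b → CWExp k → CWExp k

cwSize : ∀ {k} → CWExp k → ℕ
cwSize (vert _)    = 1
cwSize (t ⊕ s)     = cwSize t + cwSize s
cwSize (ρ _ _ _ t) = cwSize t
cwSize (η _ _ _ t) = cwSize t

cwLab : ∀ {k} (t : CWExp k) → Fin (cwSize t) → Fin k
cwLab (vert a) _ = a
cwLab (t ⊕ s) i with splitAt (cwSize t) i
... | inj₁ i′ = cwLab t i′
... | inj₂ i′ = cwLab s i′
cwLab (ρ a b _ t) i with cwLab t i == a
... | true  = b
... | false = cwLab t i
cwLab (η _ _ _ t) i = cwLab t i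

cwAdj : ∀ {k} (t : CWExp k) → Fin (cwSize t) → Fin (cwSize t) → Bool
cwAdj (vert _) _ _ = false
cwAdj (t ⊕ s) i j with splitAt (cwSize t) i | splitAt (cwSize t) j
... | inj₁ i′ | inj₁ j′ = cwAdj t i′ j′
... | inj₂ i′ | inj₂ j′ = cwAdj s i′ j′
... | inj₁ _  | inj₂ _  = false
... | inj₂ _  | inj₁ _  = false
cwAdj (ρ _ _ _ t) i j = cwAdj t i j
cwAdj (η a b _ t) i j =
  cwAdj t i j ∨ ((cwLab t i == a ∧ cwLab t j == b) ∨ (cwLab t i == b ∧ cwLab t j == a))

cwGraph : ∀ {k} → CWExp k → Graph
cwGraph t = record { n = cwSize t ; adj = cwAdj t }

InCW : ℕ → Graph → Set
InCW k G = Σ (CWExp k) λ t → cwGraph t ≅ G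

IsCW : Graph → ℕ → Set
IsCW G m = InCW m G × (∀ k → InCW k G → m ≤ k)

data NLCExp (k : ℕ) : Set where
  vert  : Fin k → NLCExp k
  times : (S : Fin k → Fin k → Bool) → NLCExp k → NLCExp k → NLCExp k
  relab : (R : Fin k → Fin k) → NLCExp k → NLCExp k

nlcSize : ∀ {k} → NLCExp k → ℕ
nlcSize (vert _)      = 1
nlcSize (times _ t s) = nlcSize t + nlcSize s
nlcSize (relab _ t)   = nlcSize t

nlcLab : ∀ {k} (t : NLCExp k) → Fin (nlcSize t) → Fin k
nlcLab (vert a) _ = a
nlcLab (times _ t s) i with splitAt (nlcSize t) i
... | inj₁ i′ = nlcLab t i′
... | inj₂ i′ = nlcLab s i′
nlcLab (relab R t) i = R (nlcLab t i)

nlcAdj : ∀ {k} (t : NLCExp k) → Fin (nlcSize t) → Fin (nlcSize t) → Bool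
nlcAdj (vert _) _ _ = false
nlcAdj (times S t s) i j with splitAt (nlcSize t) i | splitAt (nlcSize t) j
... | inj₁ i′ | inj₁ j′ = nlcAdj t i′ j′
... | inj₂ i′ | inj₂ j′ = nlcAdj s i′ j′
... | inj₁ i′ | inj₂ j′ = S (nlcLab t i′) (nlcLab s j′)
... | inj₂ i′ | inj₁ j′ = S (nlcLab t j′) (nlcLab s i′)
nlcAdj (relab _ t) i j = nlcAdj t i j

nlcGraph : ∀ {k} → NLCExp k → Graph
nlcGraph t = record { n = nlcSize t ; adj = nlcAdj t }

InNLC : ℕ → Graph → Set
InNLC k G = Σ (NLCExp k) λ t → nlcGraph t ≅ G

IsNLCW : Graph → ℕ → Set
IsNLCW G m = InNLC m G × (∀ k → InNLC k G → m ≤ k)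

-- Upper bound: take expressions t₁ for G₁ and t₂ for G₂ over k₁ and k₂ labels, and replace each
-- vertex of t₁ with label a by a copy of t₂ whose vertices all end up with label a (for clique-width
-- by relabelling every label to a with ρ, for NLC-width by one constant ∘_R). A vertex and the copy
-- replacing it carry the same label, so every later operation of t₁ treats the copy as it treated the
-- vertex; the result is an expression for G₁[G₂] over max(k₁, k₂) labels.
-- Lower bound: for simple graphs, G₁ and G₂ are the induced subgraphs of G₁[G₂] on {(u, x₀)} and on
-- {(u₀, x)}, and deleting vertices from an expression leaves an expression, over the same labels,
-- for the induced subgraph.

{-# OPTIONS --safe #-}
module Submission where

open import Defs
open import Data.Bool using (Bool; true; false; T; _∧_; _∨_; if_then_else_)
open import Data.Bool.Properties using (T-irrelevant; ∨-identityʳ; ∧-zeroʳ)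
open import Data.Empty using (⊥-elim)
open import Data.Fin using (Fin; _≟_; splitAt; remQuot; combine; inject≤; toℕ; fromℕ<)
open import Data.Fin.Properties
  using (1↔⊤; +↔⊎; *↔×; remQuot-combine; inject≤-injective; toℕ-injective; toℕ-fromℕ<; toℕ-inject≤; toℕ<n)
open import Data.List using (List; []; _∷_; allFin)
open import Data.List.Membership.Propositional using (_∈_)
open import Data.List.Membership.Propositional.Properties using (∈-allFin)
open import Data.List.Relation.Unary.Any using (here; there)
open import Data.Nat using (ℕ; _⊔_; _≤_; _<_; _<?_)
open import Data.Nat.Properties using (m≤m⊔n; m≤n⊔m; ⊔-lub)
open import Data.Product using (_×_; Σ; _,_; proj₁; proj₂)
open import Data.Product.Function.NonDependent.Propositional using (_×-↔_)
open import Data.Sum using (_⊎_; inj₁; inj₂; [_,_]; map₂)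
open import Data.Sum.Function.Propositional using (_⊎-↔_)
open import Data.Sum.Properties using (inj₁-injective; inj₂-injective; ≡-dec)
open import Data.Unit using (⊤; tt)
open import Data.Unit.Properties using () renaming (_≟_ to _≟⊤_)
open import Function using (_∘_)
open import Function.Bundles using (_↔_; Inverse; Injection; mk↔ₛ′)
open import Function.Definitions using (Injective)
open import Function.Properties.Inverse using (↔-refl; ↔-sym; ↔-trans; Inverse⇒Injection)
open import Function.Related.TypeIsomorphisms using (×-comm; ×-distribʳ-⊎)
open import Relation.Binary.Definitions using (DecidableEquality)
open import Relation.Binary.PropositionalEquality
  using (_≡_; _≢_; refl; sym; trans; cong; cong₂; subst; module ≡-Reasoning)
open import Relation.Nullary using (¬_; yes; no; T?)
open import Relation.Nullary.Decidable using (True; toWitness; fromWitness; isYes≗does; dec-true; dec-false)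

open Inverse using (to; from; strictlyInverseˡ; strictlyInverseʳ)

-- Labelled graphs

variable
  L L′ M : Set

record LabelledGraph (L : Set) : Set₁ where
  field
    Vertex : Set
    edge   : Vertex → Vertex → Bool
    label  : Vertex → L
open LabelledGraph

⟦_⟧ : Graph → LabelledGraph ⊤
⟦ G ⟧ = record { Vertex = Fin (n G) ; edge = adj G ; label = λ _ → tt }

Irreflexive : LabelledGraph L → Set
Irreflexive Γ = ∀ p → edge Γ p p ≡ false

infix 4 _≃_ _≃ₗ_

record _≃_ (Γ : LabelledGraph L) (Δ : LabelledGraph L′) : Set where
  constructor mk≃
  field
    bijection       : Vertex Γ ↔ Vertex Δ
    edge-preserving : ∀ p q → edge Δ (to bijection p) (to bijection q) ≡ edge Γ p q
open _≃_

record _≃ₗ_ (Γ Δ : LabelledGraph L) : Set where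
  constructor mk≃ₗ
  field
    iso              : Γ ≃ Δ
    label-preserving : ∀ p → label Δ (to (bijection iso) p) ≡ label Γ p
open _≃ₗ_

≅⇒≃ : {G H : Graph} → G ≅ H → ⟦ G ⟧ ≃ ⟦ H ⟧
≅⇒≃ (f , f-edge) = mk≃ f f-edge

≃⇒≅ : {G H : Graph} → ⟦ G ⟧ ≃ ⟦ H ⟧ → G ≅ H
≃⇒≅ (mk≃ f f-edge) = f , f-edge

≃-refl : {Γ : LabelledGraph L} → Γ ≃ Γ
≃-refl = mk≃ ↔-refl λ _ _ → refl

≃-sym : {Γ : LabelledGraph L} {Δ : LabelledGraph L′} → Γ ≃ Δ → Δ ≃ Γ
≃-sym {Δ = Δ} (mk≃ f f-edge) = mk≃ (↔-sym f) λ p q →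
  trans (sym (f-edge _ _)) (cong₂ (edge Δ) (strictlyInverseˡ f p) (strictlyInverseˡ f q))

≃-trans : {Γ : LabelledGraph L} {Δ : LabelledGraph L′} {Θ : LabelledGraph M} →
          Γ ≃ Δ → Δ ≃ Θ → Γ ≃ Θ
≃-trans (mk≃ f f-edge) (mk≃ g g-edge) = mk≃ (↔-trans f g) λ p q → trans (g-edge _ _) (f-edge p q)

≃ₗ-trans : {Γ Δ Θ : LabelledGraph L} → Γ ≃ₗ Δ → Δ ≃ₗ Θ → Γ ≃ₗ Θ
≃ₗ-trans (mk≃ₗ f f-label) (mk≃ₗ g g-label) = mk≃ₗ (≃-trans f g) λ p → trans (g-label _) (f-label p)

single : L → LabelledGraph L
single a = record { Vertex = ⊤ ; edge = λ _ _ → false ; label = λ _ → a }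

join : (L → L → Bool) → LabelledGraph L → LabelledGraph L → LabelledGraph L
join S Γ Δ = record { Vertex = Vertex Γ ⊎ Vertex Δ ; edge = joinEdge ; label = [ label Γ , label Δ ] }
  where
  joinEdge : Vertex Γ ⊎ Vertex Δ → Vertex Γ ⊎ Vertex Δ → Bool
  joinEdge (inj₁ p) (inj₁ q) = edge Γ p q
  joinEdge (inj₂ p) (inj₂ q) = edge Δ p q
  joinEdge (inj₁ p) (inj₂ q) = S (label Γ p) (label Δ q)
  joinEdge (inj₂ p) (inj₁ q) = S (label Γ q) (label Δ p)

relabel : (L → L′) → LabelledGraph L → LabelledGraph L′
relabel R Γ = record { Vertex = Vertex Γ ; edge = edge Γ ; label = R ∘ label Γ }

connect : {k : ℕ} → Fin k → Fin k → LabelledGraph (Fin k) → LabelledGraph (Fin k)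
connect a b Γ = record Γ { edge = λ p q →
  edge Γ p q ∨ ((label Γ p == a ∧ label Γ q == b) ∨ (label Γ p == b ∧ label Γ q == a)) }

infixl 5 _∣_

_∣_ : (Γ : LabelledGraph L) → (Vertex Γ → Bool) → LabelledGraph L
Γ ∣ keep = record
  { Vertex = Σ (Vertex Γ) (T ∘ keep)
  ; edge   = λ p q → edge Γ (proj₁ p) (proj₁ q)
  ; label  = label Γ ∘ proj₁
  }

single≃ : {a : L} {b : L′} → single a ≃ single b
single≃ = mk≃ ↔-refl λ _ _ → refl

relabel≃ : {R : L → L′} {Γ : LabelledGraph L} → relabel R Γ ≃ Γ
relabel≃ = mk≃ ↔-refl λ _ _ → refl

==-true : {k : ℕ} {x y : Fin k} → x ≡ y → (x == y) ≡ true
==-true x≡y = trans (isYes≗does (_ ≟ _)) (dec-true (_ ≟ _) x≡y)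

==-false : {k : ℕ} {x y : Fin k} → x ≢ y → (x == y) ≡ false
==-false x≢y = trans (isYes≗does (_ ≟ _)) (dec-false (_ ≟ _) x≢y)

==-injective : {k K : ℕ} {ι : Fin k → Fin K} → Injective _≡_ _≡_ ι → ∀ x y → (ι x == ι y) ≡ (x == y)
==-injective ι-injective x y with x ≟ y
... | yes refl = ==-true refl
... | no x≢y = ==-false (x≢y ∘ ι-injective)

same-label-unconnected : {k : ℕ} {c d : Fin k} → c ≢ d →
                         ∀ x → ((x == c ∧ x == d) ∨ (x == d ∧ x == c)) ≡ false
same-label-unconnected {c = c} {d} c≢d x with x ≟ c | x ≟ d
... | yes refl | yes refl = ⊥-elim (c≢d refl)
... | yes _    | no _     = refl
... | no _     | yes _    = refl
... | no _     | no _     = refl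

join-irreflexive : {S : L → L → Bool} {Γ Δ : LabelledGraph L} →
                   Irreflexive Γ → Irreflexive Δ → Irreflexive (join S Γ Δ)
join-irreflexive Γ-irreflexive Δ-irreflexive (inj₁ p) = Γ-irreflexive p
join-irreflexive Γ-irreflexive Δ-irreflexive (inj₂ q) = Δ-irreflexive q

connect-irreflexive : {k : ℕ} {a b : Fin k} {Γ : LabelledGraph (Fin k)} →
                      a ≢ b → Irreflexive Γ → Irreflexive (connect a b Γ)
connect-irreflexive {Γ = Γ} a≢b Γ-irreflexive p
  rewrite Γ-irreflexive p = same-label-unconnected a≢b (label Γ p)

join-cong : {S : L → L → Bool} {Γ Γ′ Δ Δ′ : LabelledGraph L} →
            Γ ≃ₗ Γ′ → Δ ≃ₗ Δ′ → join S Γ Δ ≃ₗ join S Γ′ Δ′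
join-cong {S = S} (mk≃ₗ (mk≃ f f-edge) f-label) (mk≃ₗ (mk≃ g g-edge) g-label) =
  mk≃ₗ (mk≃ (f ⊎-↔ g) λ { (inj₁ p) (inj₁ q) → f-edge p q
                         ; (inj₂ p) (inj₂ q) → g-edge p q
                         ; (inj₁ p) (inj₂ q) → cong₂ S (f-label p) (g-label q)
                         ; (inj₂ p) (inj₁ q) → cong₂ S (f-label q) (g-label p) })
       λ { (inj₁ p) → f-label p ; (inj₂ q) → g-label q }

relabel-cong : {R : L → L′} {Γ Δ : LabelledGraph L} → Γ ≃ₗ Δ → relabel R Γ ≃ₗ relabel R Δ
relabel-cong {R = R} (mk≃ₗ (mk≃ f f-edge) f-label) = mk≃ₗ (mk≃ f f-edge) (cong R ∘ f-label)

connect-cong : {k : ℕ} {a b : Fin k} {Γ Δ : LabelledGraph (Fin k)} →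
               Γ ≃ₗ Δ → connect a b Γ ≃ₗ connect a b Δ
connect-cong {a = a} {b} {Γ} {Δ} (mk≃ₗ (mk≃ f f-edge) f-label) = mk≃ₗ (mk≃ f connect-edge) f-label
  where
  connect-edge : ∀ p q → edge (connect a b Δ) (to f p) (to f q) ≡ edge (connect a b Γ) p q
  connect-edge p q rewrite f-edge p q | f-label p | f-label q = refl

kept-≡ : {A : Set} {keep : A → Bool} {p q : Σ A (T ∘ keep)} → proj₁ p ≡ proj₁ q → p ≡ q
kept-≡ {p = a , k} {q = .a , k′} refl = cong (a ,_) (T-irrelevant k k′)

∣-cong : {Γ : LabelledGraph L} {Δ : LabelledGraph L′} (f : Γ ≃ Δ) (keep : Vertex Δ → Bool) →
         Γ ∣ (keep ∘ to (bijection f)) ≃ Δ ∣ keep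
∣-cong (mk≃ f f-edge) keep = mk≃ (mk↔ₛ′ (λ (p , k) → to f p , k) from′
  (λ (q , _) → kept-≡ (strictlyInverseˡ f q)) (λ (p , _) → kept-≡ (strictlyInverseʳ f p)))
  λ p q → f-edge (proj₁ p) (proj₁ q)
  where
  from′ : Σ _ (T ∘ keep) → Σ _ (T ∘ keep ∘ to f)
  from′ (q , k) = from f q , subst (T ∘ keep) (sym (strictlyInverseˡ f q)) k

single-∣ : {a : L} {keep : ⊤ → Bool} → T (keep tt) → single a ≃ₗ single a ∣ keep
single-∣ k = mk≃ₗ (mk≃ (mk↔ₛ′ (λ _ → tt , k) proj₁ (λ _ → kept-≡ refl) (λ _ → refl)) λ _ _ → refl)
                  λ _ → refl

join-emptyʳ : {S : L → L → Bool} {Γ Δ : LabelledGraph L} → ¬ Vertex Δ → Γ ≃ₗ join S Γ Δ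
join-emptyʳ ∅ = mk≃ₗ (mk≃ (mk↔ₛ′ inj₁ [ (λ p → p) , ⊥-elim ∘ ∅ ]
  (λ { (inj₁ _) → refl ; (inj₂ q) → ⊥-elim (∅ q) }) (λ _ → refl)) λ _ _ → refl) λ _ → refl

join-emptyˡ : {S : L → L → Bool} {Γ Δ : LabelledGraph L} → ¬ Vertex Γ → Δ ≃ₗ join S Γ Δ
join-emptyˡ ∅ = mk≃ₗ (mk≃ (mk↔ₛ′ inj₂ [ ⊥-elim ∘ ∅ , (λ q → q) ]
  (λ { (inj₁ p) → ⊥-elim (∅ p) ; (inj₂ _) → refl }) (λ _ → refl)) λ _ _ → refl) λ _ → refl

∣-join : {S : L → L → Bool} {Γ Δ : LabelledGraph L} {keep : Vertex Γ ⊎ Vertex Δ → Bool} →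
         join S (Γ ∣ keep ∘ inj₁) (Δ ∣ keep ∘ inj₂) ≃ₗ join S Γ Δ ∣ keep
∣-join = mk≃ₗ (mk≃ (mk↔ₛ′
  (λ { (inj₁ (p , k)) → inj₁ p , k ; (inj₂ (q , k)) → inj₂ q , k })
  (λ { (inj₁ p , k) → inj₁ (p , k) ; (inj₂ q , k) → inj₂ (q , k) })
  (λ { (inj₁ _ , _) → refl ; (inj₂ _ , _) → refl })
  (λ { (inj₁ _) → refl ; (inj₂ _) → refl }))
  λ { (inj₁ _) (inj₁ _) → refl ; (inj₂ _) (inj₂ _) → refl
    ; (inj₁ _) (inj₂ _) → refl ; (inj₂ _) (inj₁ _) → refl })
  λ { (inj₁ _) → refl ; (inj₂ _) → refl }

-- Lexicographic products

-- Γ ≅ Δ[Θ], witnessed by a splitting of the vertices rather than by an equality test on Vertex Δ.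
record IsLex (Γ : LabelledGraph L) (Δ : LabelledGraph L′) (Θ : LabelledGraph M) : Set where
  field
    split : Vertex Γ ↔ (Vertex Δ × Vertex Θ)

  outer : Vertex Γ → Vertex Δ
  outer p = proj₁ (to split p)

  inner : Vertex Γ → Vertex Θ
  inner p = proj₂ (to split p)

  field
    edge-inside : ∀ p q → outer p ≡ outer q → edge Γ p q ≡ edge Θ (inner p) (inner q)
    edge-across : ∀ p q → outer p ≢ outer q → edge Γ p q ≡ edge Δ (outer p) (outer q)

record IsLabelledLex (ι : L′ → L) (Γ : LabelledGraph L) (Δ : LabelledGraph L′) (Θ : LabelledGraph M) :
                     Set where
  field
    isLex : IsLex Γ Δ Θ
  open IsLex isLex public
  field
    label-outer : ∀ p → label Γ p ≡ ι (label Δ (outer p))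

isLex-unique : {Γ : LabelledGraph L} {Δ : LabelledGraph L′} {Θ : LabelledGraph M}
               {L₁ L₁′ M₁ : Set} {Γ′ : LabelledGraph L₁} {Δ′ : LabelledGraph L₁′} {Θ′ : LabelledGraph M₁} →
               IsLex Γ Δ Θ → IsLex Γ′ Δ′ Θ′ → Δ ≃ Δ′ → Θ ≃ Θ′ → DecidableEquality (Vertex Δ′) → Γ ≃ Γ′
isLex-unique {Γ = Γ} {Δ} {Θ} {Γ′ = Γ′} {Δ′} {Θ′} P P′ (mk≃ f f-edge) (mk≃ g g-edge) _≟′_ = mk≃ φ φ-edge
  where
  module P = IsLex P
  module P′ = IsLex P′
  open ≡-Reasoning

  φ : Vertex Γ ↔ Vertex Γ′
  φ = ↔-trans P.split (↔-trans (f ×-↔ g) (↔-sym P′.split))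

  outer-φ : ∀ p → P′.outer (to φ p) ≡ to f (P.outer p)
  outer-φ p = cong proj₁ (strictlyInverseˡ P′.split _)

  inner-φ : ∀ p → P′.inner (to φ p) ≡ to g (P.inner p)
  inner-φ p = cong proj₂ (strictlyInverseˡ P′.split _)

  φ-edge : ∀ p q → edge Γ′ (to φ p) (to φ q) ≡ edge Γ p q
  φ-edge p q with P′.outer (to φ p) ≟′ P′.outer (to φ q)
  ... | yes same = begin
    edge Γ′ (to φ p) (to φ q)                        ≡⟨ P′.edge-inside _ _ same ⟩
    edge Θ′ (P′.inner (to φ p)) (P′.inner (to φ q))  ≡⟨ cong₂ (edge Θ′) (inner-φ p) (inner-φ q) ⟩
    edge Θ′ (to g (P.inner p)) (to g (P.inner q))    ≡⟨ g-edge _ _ ⟩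
    edge Θ (P.inner p) (P.inner q)                   ≡⟨ P.edge-inside p q outer-same ⟨
    edge Γ p q                                       ∎
    where
    outer-same : P.outer p ≡ P.outer q
    outer-same = Injection.injective (Inverse⇒Injection f)
                   (trans (sym (outer-φ p)) (trans same (outer-φ q)))
  ... | no differ = begin
    edge Γ′ (to φ p) (to φ q)                        ≡⟨ P′.edge-across _ _ differ ⟩
    edge Δ′ (P′.outer (to φ p)) (P′.outer (to φ q))  ≡⟨ cong₂ (edge Δ′) (outer-φ p) (outer-φ q) ⟩
    edge Δ′ (to f (P.outer p)) (to f (P.outer q))    ≡⟨ f-edge _ _ ⟩
    edge Δ (P.outer p) (P.outer q)                   ≡⟨ P.edge-across p q (differ ∘ outer-differ) ⟨
    edge Γ p q                                       ∎
    where
    outer-differ : P.outer p ≡ P.outer q → P′.outer (to φ p) ≡ P′.outer (to φ q)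
    outer-differ same = trans (outer-φ p) (trans (cong (to f) same) (sym (outer-φ q)))

isLex-unitʳ : {Γ : LabelledGraph L} {Δ : LabelledGraph L′} {a : M} →
              IsLex Γ Δ (single a) → Irreflexive Δ → DecidableEquality (Vertex Δ) → Γ ≃ Δ
isLex-unitʳ {Δ = Δ} {a} P Δ-irreflexive _≟Δ_ = isLex-unique P Δ-isLex ≃-refl ≃-refl _≟Δ_
  where
  Δ-isLex : IsLex Δ Δ (single a)
  Δ-isLex = record
    { split       = mk↔ₛ′ (_, tt) proj₁ (λ _ → refl) (λ _ → refl)
    ; edge-inside = λ { p .p refl → Δ-irreflexive p }
    ; edge-across = λ _ _ _ → refl
    }

module _ {ι : L′ → L} {Θ : LabelledGraph M} where

  block-isLex : {a : L′} {B : LabelledGraph L} →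
                B ≃ Θ → (∀ p → label B p ≡ ι a) → IsLabelledLex ι B (single a) Θ
  block-isLex (mk≃ f f-edge) B-label = record
    { isLex = record
      { split       = mk↔ₛ′ (λ p → tt , to f p) (λ (_ , x) → from f x)
                            (λ (_ , x) → cong (tt ,_) (strictlyInverseˡ f x)) (strictlyInverseʳ f)
      ; edge-inside = λ p q _ → sym (f-edge p q)
      ; edge-across = λ _ _ tt≢tt → ⊥-elim (tt≢tt refl)
      }
    ; label-outer = B-label
    }

  join-isLex : {S : L → L → Bool} {S′ : L′ → L′ → Bool}
               {Γ₁ Γ₂ : LabelledGraph L} {Δ₁ Δ₂ : LabelledGraph L′} →
               (∀ a b → S (ι a) (ι b) ≡ S′ a b) →
               IsLabelledLex ι Γ₁ Δ₁ Θ → IsLabelledLex ι Γ₂ Δ₂ Θ →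
               IsLabelledLex ι (join S Γ₁ Γ₂) (join S′ Δ₁ Δ₂) Θ
  join-isLex {S = S} S-ι P₁ P₂ = record
    { isLex = record
      { split       = ↔-trans (P₁.split ⊎-↔ P₂.split) (↔-sym ×-distribʳ-⊎)
      ; edge-inside = λ { (inj₁ p) (inj₁ q) same → P₁.edge-inside p q (inj₁-injective same)
                        ; (inj₂ p) (inj₂ q) same → P₂.edge-inside p q (inj₂-injective same)
                        ; (inj₁ _) (inj₂ _) () ; (inj₂ _) (inj₁ _) () }
      ; edge-across = λ { (inj₁ p) (inj₁ q) differ → P₁.edge-across p q (differ ∘ cong inj₁)
                        ; (inj₂ p) (inj₂ q) differ → P₂.edge-across p q (differ ∘ cong inj₂)
                        ; (inj₁ p) (inj₂ q) _ →
                            trans (cong₂ S (P₁.label-outer p) (P₂.label-outer q)) (S-ι _ _)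
                        ; (inj₂ p) (inj₁ q) _ →
                            trans (cong₂ S (P₁.label-outer q) (P₂.label-outer p)) (S-ι _ _) }
      }
    ; label-outer = λ { (inj₁ p) → P₁.label-outer p ; (inj₂ q) → P₂.label-outer q }
    }
    where
    module P₁ = IsLabelledLex P₁
    module P₂ = IsLabelledLex P₂

  relabel-isLex : {R : L → L} {R′ : L′ → L′} {Γ : LabelledGraph L} {Δ : LabelledGraph L′} →
                  (∀ a → R (ι a) ≡ ι (R′ a)) →
                  IsLabelledLex ι Γ Δ Θ → IsLabelledLex ι (relabel R Γ) (relabel R′ Δ) Θ
  relabel-isLex {R = R} R-ι P = record
    { isLex       = record { IsLex isLex }
    ; label-outer = λ p → trans (cong R (label-outer p)) (R-ι _)
    }
    where open IsLabelledLex P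

connect-isLex : {k K : ℕ} {ι : Fin k → Fin K} {Θ : LabelledGraph M} {a b : Fin k}
                {Γ : LabelledGraph (Fin K)} {Δ : LabelledGraph (Fin k)} →
                Injective _≡_ _≡_ ι → a ≢ b →
                IsLabelledLex ι Γ Δ Θ → IsLabelledLex ι (connect (ι a) (ι b) Γ) (connect a b Δ) Θ
connect-isLex {ι = ι} {Θ = Θ} {a} {b} {Γ} {Δ} ι-injective a≢b P = record
  { isLex = record { split = split ; edge-inside = inside ; edge-across = across }
  ; label-outer = label-outer
  }
  where
  open IsLabelledLex P

  inside : ∀ p q → outer p ≡ outer q → edge (connect (ι a) (ι b) Γ) p q ≡ edge Θ (inner p) (inner q)
  inside p q same rewrite edge-inside p q same | label-outer p | label-outer q | same =
    trans (cong (edge Θ (inner p) (inner q) ∨_)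
                (same-label-unconnected (a≢b ∘ ι-injective) (ι (label Δ (outer q)))))
          (∨-identityʳ _)

  across : ∀ p q → outer p ≢ outer q →
           edge (connect (ι a) (ι b) Γ) p q ≡ edge (connect a b Δ) (outer p) (outer q)
  across p q differ rewrite edge-across p q differ | label-outer p | label-outer q
    | ==-injective ι-injective (label Δ (outer p)) a | ==-injective ι-injective (label Δ (outer p)) b
    | ==-injective ι-injective (label Δ (outer q)) a | ==-injective ι-injective (label Δ (outer q)) b
    = refl

fibre-↔ : {A B C : Set} (f : A ↔ (B × C)) (_≟B_ : DecidableEquality B) (b : B) →
          C ↔ Σ A (λ a → True (proj₁ (to f a) ≟B b))
fibre-↔ f _≟B_ b = mk↔ₛ′
  (λ c → from f (b , c) , fromWitness (cong proj₁ (strictlyInverseˡ f (b , c))))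
  (λ (a , _) → proj₂ (to f a))
  (λ (a , over-b) → kept-≡ (trans (cong (λ b′ → from f (b′ , proj₂ (to f a))) (sym (toWitness over-b)))
                                  (strictlyInverseʳ f a)))
  (λ c → cong proj₂ (strictlyInverseˡ f (b , c)))

module _ (G₁ G₂ : Graph) where

  lexOuter : Fin (n (lex G₁ G₂)) → Fin (n G₁)
  lexOuter p = proj₁ (remQuot {n G₁} (n G₂) p)

  lexInner : Fin (n (lex G₁ G₂)) → Fin (n G₂)
  lexInner p = proj₂ (remQuot {n G₁} (n G₂) p)

  lex-adj-combine : ∀ u x v y →
                    adj (lex G₁ G₂) (combine u x) (combine v y) ≡ adj G₁ u v ∨ ((u == v) ∧ adj G₂ x y)
  lex-adj-combine u x v y = cong₂ lexEdge (remQuot-combine u x) (remQuot-combine v y)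
    where
    lexEdge : Fin (n G₁) × Fin (n G₂) → Fin (n G₁) × Fin (n G₂) → Bool
    lexEdge (u , x) (v , y) = adj G₁ u v ∨ ((u == v) ∧ adj G₂ x y)

  same-outer-adj : Irreflexive ⟦ G₁ ⟧ → ∀ u b → adj G₁ u u ∨ ((u == u) ∧ b) ≡ b
  same-outer-adj G₁-irreflexive u b = cong₂ (λ e s → e ∨ (s ∧ b)) (G₁-irreflexive u) (==-true refl)

  lex-isLex : Irreflexive ⟦ G₁ ⟧ → IsLex ⟦ lex G₁ G₂ ⟧ ⟦ G₁ ⟧ ⟦ G₂ ⟧
  lex-isLex G₁-irreflexive = record
    { split       = *↔× {n G₁} {n G₂}
    ; edge-inside = λ p q same →
        trans (cong (λ v → adj G₁ (lexOuter p) v ∨ ((lexOuter p == v) ∧ inner-adj p q)) (sym same))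
              (same-outer-adj G₁-irreflexive (lexOuter p) (inner-adj p q))
    ; edge-across = λ p q differ →
        trans (cong (λ s → adj G₁ (lexOuter p) (lexOuter q) ∨ (s ∧ inner-adj p q)) (==-false differ))
              (∨-identityʳ _)
    }
    where
    inner-adj : Fin (n (lex G₁ G₂)) → Fin (n (lex G₁ G₂)) → Bool
    inner-adj p q = adj G₂ (lexInner p) (lexInner q)

  lex-fibre : Irreflexive ⟦ G₁ ⟧ → (u : Fin (n G₁)) →
              ⟦ G₂ ⟧ ≃ ⟦ lex G₁ G₂ ⟧ ∣ (λ p → lexOuter p == u)
  lex-fibre G₁-irreflexive u = mk≃ (fibre-↔ (*↔× {n G₁} {n G₂}) _≟_ u) λ x y →
    trans (lex-adj-combine u x u y) (same-outer-adj G₁-irreflexive u (adj G₂ x y))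

  lex-section : Irreflexive ⟦ G₂ ⟧ → (x : Fin (n G₂)) →
                ⟦ G₁ ⟧ ≃ ⟦ lex G₁ G₂ ⟧ ∣ (λ p → lexInner p == x)
  lex-section G₂-irreflexive x = mk≃ (fibre-↔ (↔-trans (*↔× {n G₁} {n G₂}) (×-comm _ _)) _≟_ x) λ u v →
    trans (lex-adj-combine u x v x)
          (trans (cong (λ e → adj G₁ u v ∨ ((u == v) ∧ e)) (G₂-irreflexive x))
                 (trans (cong (adj G₁ u v ∨_) (∧-zeroʳ (u == v))) (∨-identityʳ _)))

-- Clique-width expressions

rename : {k : ℕ} → Fin k → Fin k → Fin k → Fin k
rename a b x = if x == a then b else x

rename-injective : {k K : ℕ} {ι : Fin k → Fin K} → Injective _≡_ _≡_ ι →
                   ∀ a b x → rename (ι a) (ι b) (ι x) ≡ ι (rename a b x)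
rename-injective ι-injective a b x rewrite ==-injective ι-injective x a with x == a
... | true  = refl
... | false = refl

-- Semantics on vertex types built from ⊤ and ⊎, so that no Fin arithmetic is involved.
cw⟦_⟧ : {k : ℕ} → CWExp k → LabelledGraph (Fin k)
cw⟦ vert a ⟧    = single a
cw⟦ t ⊕ s ⟧     = join (λ _ _ → false) cw⟦ t ⟧ cw⟦ s ⟧
cw⟦ ρ a b _ t ⟧ = relabel (rename a b) cw⟦ t ⟧
cw⟦ η a b _ t ⟧ = connect a b cw⟦ t ⟧

module _ {k : ℕ} where

  cwVertices : (t : CWExp k) → Fin (cwSize t) ↔ Vertex cw⟦ t ⟧
  cwVertices (vert _)    = 1↔⊤
  cwVertices (t ⊕ s)     = ↔-trans +↔⊎ (cwVertices t ⊎-↔ cwVertices s)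
  cwVertices (ρ _ _ _ t) = cwVertices t
  cwVertices (η _ _ _ t) = cwVertices t

  cwLab-label : (t : CWExp k) (i : Fin (cwSize t)) →
                cwLab t i ≡ label cw⟦ t ⟧ (to (cwVertices t) i)
  cwLab-label (vert _) _ = refl
  cwLab-label (t ⊕ s) i with splitAt (cwSize t) i
  ... | inj₁ i′ = cwLab-label t i′
  ... | inj₂ i′ = cwLab-label s i′
  cwLab-label (ρ a b _ t) i rewrite sym (cwLab-label t i) with cwLab t i == a
  ... | true  = refl
  ... | false = refl
  cwLab-label (η _ _ _ t) i = cwLab-label t i

  cwAdj-edge : (t : CWExp k) (i j : Fin (cwSize t)) →
               cwAdj t i j ≡ edge cw⟦ t ⟧ (to (cwVertices t) i) (to (cwVertices t) j)
  cwAdj-edge (vert _) _ _ = refl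
  cwAdj-edge (t ⊕ s) i j with splitAt (cwSize t) i | splitAt (cwSize t) j
  ... | inj₁ i′ | inj₁ j′ = cwAdj-edge t i′ j′
  ... | inj₂ i′ | inj₂ j′ = cwAdj-edge s i′ j′
  ... | inj₁ _  | inj₂ _  = refl
  ... | inj₂ _  | inj₁ _  = refl
  cwAdj-edge (ρ _ _ _ t) i j = cwAdj-edge t i j
  cwAdj-edge (η _ _ _ t) i j rewrite cwAdj-edge t i j | cwLab-label t i | cwLab-label t j = refl

  cwGraph≃ : (t : CWExp k) → ⟦ cwGraph t ⟧ ≃ cw⟦ t ⟧
  cwGraph≃ t = mk≃ (cwVertices t) λ i j → sym (cwAdj-edge t i j)

  cw-vertex : (t : CWExp k) → Vertex cw⟦ t ⟧
  cw-vertex (vert _)    = tt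
  cw-vertex (t ⊕ _)     = inj₁ (cw-vertex t)
  cw-vertex (ρ _ _ _ t) = cw-vertex t
  cw-vertex (η _ _ _ t) = cw-vertex t

  cw-≟ : (t : CWExp k) → DecidableEquality (Vertex cw⟦ t ⟧)
  cw-≟ (vert _)    = _≟⊤_
  cw-≟ (t ⊕ s)     = ≡-dec (cw-≟ t) (cw-≟ s)
  cw-≟ (ρ _ _ _ t) = cw-≟ t
  cw-≟ (η _ _ _ t) = cw-≟ t

  cw-irreflexive : (t : CWExp k) → Irreflexive cw⟦ t ⟧
  cw-irreflexive (vert _)      _ = refl
  cw-irreflexive (t ⊕ s)       = join-irreflexive (cw-irreflexive t) (cw-irreflexive s)
  cw-irreflexive (ρ _ _ _ t)   = cw-irreflexive t
  cw-irreflexive (η _ _ a≢b t) = connect-irreflexive {Γ = cw⟦ t ⟧} a≢b (cw-irreflexive t)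

  cw-restrict : (t : CWExp k) (keep : Vertex cw⟦ t ⟧ → Bool) →
                ¬ Vertex (cw⟦ t ⟧ ∣ keep) ⊎ Σ (CWExp k) (λ t′ → cw⟦ t′ ⟧ ≃ₗ cw⟦ t ⟧ ∣ keep)
  cw-restrict (vert a) keep with T? (keep tt)
  ... | yes kept = inj₂ (vert a , single-∣ kept)
  ... | no dropped = inj₁ (dropped ∘ proj₂)
  cw-restrict (t ⊕ s) keep with cw-restrict t (keep ∘ inj₁) | cw-restrict s (keep ∘ inj₂)
  ... | inj₁ ∅₁       | inj₁ ∅₂       = inj₁ λ { (inj₁ p , k) → ∅₁ (p , k) ; (inj₂ q , k) → ∅₂ (q , k) }
  ... | inj₂ (t′ , f) | inj₁ ∅₂       = inj₂ (t′ , ≃ₗ-trans f (≃ₗ-trans (join-emptyʳ ∅₂) ∣-join))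
  ... | inj₁ ∅₁       | inj₂ (s′ , g) = inj₂ (s′ , ≃ₗ-trans g (≃ₗ-trans (join-emptyˡ ∅₁) ∣-join))
  ... | inj₂ (t′ , f) | inj₂ (s′ , g) = inj₂ (t′ ⊕ s′ , ≃ₗ-trans (join-cong f g) ∣-join)
  cw-restrict (ρ a b a≢b t) keep =
    map₂ (λ (t′ , f) → ρ a b a≢b t′ , relabel-cong {R = rename a b} f) (cw-restrict t keep)
  cw-restrict (η a b a≢b t) keep =
    map₂ (λ (t′ , f) → η a b a≢b t′ , connect-cong {a = a} {b} f) (cw-restrict t keep)

module CWSubstitution {k K : ℕ} (ι : Fin k → Fin K) (ι-injective : Injective _≡_ _≡_ ι)
                      (block : Fin K → CWExp K) where

  substitute : CWExp k → CWExp K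
  substitute (vert a)      = block (ι a)
  substitute (t ⊕ s)       = substitute t ⊕ substitute s
  substitute (ρ a b a≢b t) = ρ (ι a) (ι b) (a≢b ∘ ι-injective) (substitute t)
  substitute (η a b a≢b t) = η (ι a) (ι b) (a≢b ∘ ι-injective) (substitute t)

  substitute-isLex : {Θ : LabelledGraph M} →
                     (∀ a → cw⟦ block a ⟧ ≃ Θ) → (∀ a p → label cw⟦ block a ⟧ p ≡ a) →
                     (t : CWExp k) → IsLabelledLex ι cw⟦ substitute t ⟧ cw⟦ t ⟧ Θ
  substitute-isLex block≃ block-label = go
    where
    go : (t : CWExp k) → IsLabelledLex ι cw⟦ substitute t ⟧ cw⟦ t ⟧ _
    go (vert a)      = block-isLex (block≃ (ι a)) (block-label (ι a))
    go (t ⊕ s)       = join-isLex (λ _ _ → refl) (go t) (go s)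
    go (ρ a b _ t)   =
      relabel-isLex {R = rename (ι a) (ι b)} {rename a b} (rename-injective ι-injective a b) (go t)
    go (η a b a≢b t) = connect-isLex ι-injective a≢b (go t)

cwMap : {k K : ℕ} (ι : Fin k → Fin K) → Injective _≡_ _≡_ ι → CWExp k → CWExp K
cwMap ι ι-injective = CWSubstitution.substitute ι ι-injective vert

-- Relabelling is substitution of single vertices, and Δ[K₁] ≅ Δ.
cwMap-≃ : {k K : ℕ} (ι : Fin k → Fin K) (ι-injective : Injective _≡_ _≡_ ι) (t : CWExp k) →
          cw⟦ cwMap ι ι-injective t ⟧ ≃ cw⟦ t ⟧
cwMap-≃ ι ι-injective t = isLex-unitʳ (IsLabelledLex.isLex t[K₁]) (cw-irreflexive t) (cw-≟ t)
  where
  t[K₁] : IsLabelledLex ι cw⟦ cwMap ι ι-injective t ⟧ cw⟦ t ⟧ (single tt)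
  t[K₁] = CWSubstitution.substitute-isLex ι ι-injective vert (λ _ → single≃) (λ _ _ → refl) t

collapseTo : {k : ℕ} → Fin k → List (Fin k) → CWExp k → CWExp k
collapseTo a []       t = t
collapseTo a (b ∷ bs) t with b ≟ a
... | yes _   = collapseTo a bs t
... | no b≢a = collapseTo a bs (ρ b a b≢a t)

collapseTo-≃ : {k : ℕ} (a : Fin k) (bs : List (Fin k)) (t : CWExp k) → cw⟦ collapseTo a bs t ⟧ ≃ cw⟦ t ⟧
collapseTo-≃ a []       t = ≃-refl
collapseTo-≃ a (b ∷ bs) t with b ≟ a
... | yes _   = collapseTo-≃ a bs t
... | no b≢a = ≃-trans (collapseTo-≃ a bs (ρ b a b≢a t)) (relabel≃ {R = rename b a})

rename-∈ : {k : ℕ} {a b x : Fin k} {bs : List (Fin k)} → x ∈ a ∷ b ∷ bs → rename b a x ∈ a ∷ bs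
rename-∈ {b = b} {x} x∈ with x ≟ b
... | yes _ = here refl
rename-∈ (here x≡a)          | no _   = here x≡a
rename-∈ (there (here x≡b))  | no x≢b = ⊥-elim (x≢b x≡b)
rename-∈ (there (there x∈))  | no _   = there x∈

collapseTo-label : {k : ℕ} (a : Fin k) (bs : List (Fin k)) (t : CWExp k) →
                   (∀ p → label cw⟦ t ⟧ p ∈ a ∷ bs) → ∀ p → label cw⟦ collapseTo a bs t ⟧ p ≡ a
collapseTo-label a [] t labels p with labels p
... | here p≡a = p≡a
collapseTo-label a (b ∷ bs) t labels with b ≟ a
... | yes refl = collapseTo-label a bs t λ p → drop-duplicate (labels p)
  where
  drop-duplicate : ∀ {x} → x ∈ a ∷ a ∷ bs → x ∈ a ∷ bs
  drop-duplicate (here x≡a) = here x≡a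
  drop-duplicate (there x∈) = x∈
... | no b≢a = collapseTo-label a bs (ρ b a b≢a t) (rename-∈ ∘ labels)

cw-substitution : {k₁ k₂ : ℕ} (t₁ : CWExp k₁) (t₂ : CWExp k₂) →
                  Σ (CWExp (k₁ ⊔ k₂)) λ t → IsLex cw⟦ t ⟧ cw⟦ t₁ ⟧ cw⟦ t₂ ⟧
cw-substitution {k₁} {k₂} t₁ t₂ =
  substitute t₁ , IsLabelledLex.isLex (substitute-isLex block≃ block-label t₁)
  where
  ι₁ : Fin k₁ → Fin (k₁ ⊔ k₂)
  ι₁ x = inject≤ x (m≤m⊔n k₁ k₂)
  ι₂ : Fin k₂ → Fin (k₁ ⊔ k₂)
  ι₂ x = inject≤ x (m≤n⊔m k₁ k₂)
  ι₂-injective : Injective _≡_ _≡_ ι₂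
  ι₂-injective = inject≤-injective _ _ _ _

  block : Fin (k₁ ⊔ k₂) → CWExp (k₁ ⊔ k₂)
  block a = collapseTo a (allFin _) (cwMap ι₂ ι₂-injective t₂)
  block≃ : ∀ a → cw⟦ block a ⟧ ≃ cw⟦ t₂ ⟧
  block≃ a = ≃-trans (collapseTo-≃ a (allFin _) _) (cwMap-≃ ι₂ ι₂-injective t₂)
  block-label : ∀ a p → label cw⟦ block a ⟧ p ≡ a
  block-label a = collapseTo-label a (allFin _) (cwMap ι₂ ι₂-injective t₂) λ _ → there (∈-allFin _)

  open CWSubstitution ι₁ (inject≤-injective _ _ _ _) block

-- NLC-width expressions

nlc⟦_⟧ : {k : ℕ} → NLCExp k → LabelledGraph (Fin k)
nlc⟦ vert a ⟧      = single a
nlc⟦ times S t s ⟧ = join S nlc⟦ t ⟧ nlc⟦ s ⟧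
nlc⟦ relab R t ⟧   = relabel R nlc⟦ t ⟧

module _ {k : ℕ} where

  nlcVertices : (t : NLCExp k) → Fin (nlcSize t) ↔ Vertex nlc⟦ t ⟧
  nlcVertices (vert _)      = 1↔⊤
  nlcVertices (times _ t s) = ↔-trans +↔⊎ (nlcVertices t ⊎-↔ nlcVertices s)
  nlcVertices (relab _ t)   = nlcVertices t

  nlcLab-label : (t : NLCExp k) (i : Fin (nlcSize t)) →
                 nlcLab t i ≡ label nlc⟦ t ⟧ (to (nlcVertices t) i)
  nlcLab-label (vert _) _ = refl
  nlcLab-label (times _ t s) i with splitAt (nlcSize t) i
  ... | inj₁ i′ = nlcLab-label t i′
  ... | inj₂ i′ = nlcLab-label s i′
  nlcLab-label (relab R t) i = cong R (nlcLab-label t i)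

  nlcAdj-edge : (t : NLCExp k) (i j : Fin (nlcSize t)) →
                nlcAdj t i j ≡ edge nlc⟦ t ⟧ (to (nlcVertices t) i) (to (nlcVertices t) j)
  nlcAdj-edge (vert _) _ _ = refl
  nlcAdj-edge (times S t s) i j with splitAt (nlcSize t) i | splitAt (nlcSize t) j
  ... | inj₁ i′ | inj₁ j′ = nlcAdj-edge t i′ j′
  ... | inj₂ i′ | inj₂ j′ = nlcAdj-edge s i′ j′
  ... | inj₁ i′ | inj₂ j′ = cong₂ S (nlcLab-label t i′) (nlcLab-label s j′)
  ... | inj₂ i′ | inj₁ j′ = cong₂ S (nlcLab-label t j′) (nlcLab-label s i′)
  nlcAdj-edge (relab _ t) i j = nlcAdj-edge t i j

  nlcGraph≃ : (t : NLCExp k) → ⟦ nlcGraph t ⟧ ≃ nlc⟦ t ⟧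
  nlcGraph≃ t = mk≃ (nlcVertices t) λ i j → sym (nlcAdj-edge t i j)

  nlc-vertex : (t : NLCExp k) → Vertex nlc⟦ t ⟧
  nlc-vertex (vert _)      = tt
  nlc-vertex (times _ t _) = inj₁ (nlc-vertex t)
  nlc-vertex (relab _ t)   = nlc-vertex t

  nlc-≟ : (t : NLCExp k) → DecidableEquality (Vertex nlc⟦ t ⟧)
  nlc-≟ (vert _)      = _≟⊤_
  nlc-≟ (times _ t s) = ≡-dec (nlc-≟ t) (nlc-≟ s)
  nlc-≟ (relab _ t)   = nlc-≟ t

  nlc-irreflexive : (t : NLCExp k) → Irreflexive nlc⟦ t ⟧
  nlc-irreflexive (vert _)      _ = refl
  nlc-irreflexive (times _ t s) = join-irreflexive (nlc-irreflexive t) (nlc-irreflexive s)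
  nlc-irreflexive (relab _ t)   = nlc-irreflexive t

  nlc-restrict : (t : NLCExp k) (keep : Vertex nlc⟦ t ⟧ → Bool) →
                 ¬ Vertex (nlc⟦ t ⟧ ∣ keep) ⊎ Σ (NLCExp k) (λ t′ → nlc⟦ t′ ⟧ ≃ₗ nlc⟦ t ⟧ ∣ keep)
  nlc-restrict (vert a) keep with T? (keep tt)
  ... | yes kept = inj₂ (vert a , single-∣ kept)
  ... | no dropped = inj₁ (dropped ∘ proj₂)
  nlc-restrict (times S t s) keep with nlc-restrict t (keep ∘ inj₁) | nlc-restrict s (keep ∘ inj₂)
  ... | inj₁ ∅₁       | inj₁ ∅₂       = inj₁ λ { (inj₁ p , k) → ∅₁ (p , k) ; (inj₂ q , k) → ∅₂ (q , k) }
  ... | inj₂ (t′ , f) | inj₁ ∅₂       = inj₂ (t′ , ≃ₗ-trans f (≃ₗ-trans (join-emptyʳ ∅₂) ∣-join))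
  ... | inj₁ ∅₁       | inj₂ (s′ , g) = inj₂ (s′ , ≃ₗ-trans g (≃ₗ-trans (join-emptyˡ ∅₁) ∣-join))
  ... | inj₂ (t′ , f) | inj₂ (s′ , g) = inj₂ (times S t′ s′ , ≃ₗ-trans (join-cong f g) ∣-join)
  nlc-restrict (relab R t) keep =
    map₂ (λ (t′ , f) → relab R t′ , relabel-cong {R = R} f) (nlc-restrict t keep)

-- Only r ∘ ι = id matters: every label occurring in substitute t lies in the image of ι.
module NLCSubstitution {k K : ℕ} (ι : Fin k → Fin K) (r : Fin K → Fin k) (block : Fin K → NLCExp K) where

  substitute : NLCExp k → NLCExp K
  substitute (vert a)      = block (ι a)
  substitute (times S t s) = times (λ x y → S (r x) (r y)) (substitute t) (substitute s)
  substitute (relab R t)   = relab (ι ∘ R ∘ r) (substitute t)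

  substitute-isLex : {Θ : LabelledGraph M} → (∀ a → r (ι a) ≡ a) →
                     (∀ a → nlc⟦ block a ⟧ ≃ Θ) → (∀ a p → label nlc⟦ block a ⟧ p ≡ a) →
                     (t : NLCExp k) → IsLabelledLex ι nlc⟦ substitute t ⟧ nlc⟦ t ⟧ Θ
  substitute-isLex r∘ι block≃ block-label = go
    where
    go : (t : NLCExp k) → IsLabelledLex ι nlc⟦ substitute t ⟧ nlc⟦ t ⟧ _
    go (vert a)      = block-isLex (block≃ (ι a)) (block-label (ι a))
    go (times S t s) = join-isLex (λ a b → cong₂ S (r∘ι a) (r∘ι b)) (go t) (go s)
    go (relab R t)   = relabel-isLex {R = ι ∘ R ∘ r} {R} (λ a → cong (ι ∘ R) (r∘ι a)) (go t)

nlcMap : {k K : ℕ} (ι : Fin k → Fin K) (r : Fin K → Fin k) → NLCExp k → NLCExp K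
nlcMap ι r = NLCSubstitution.substitute ι r vert

nlcMap-≃ : {k K : ℕ} (ι : Fin k → Fin K) (r : Fin K → Fin k) → (∀ a → r (ι a) ≡ a) →
           (t : NLCExp k) → nlc⟦ nlcMap ι r t ⟧ ≃ nlc⟦ t ⟧
nlcMap-≃ ι r r∘ι t = isLex-unitʳ (IsLabelledLex.isLex t[K₁]) (nlc-irreflexive t) (nlc-≟ t)
  where
  t[K₁] : IsLabelledLex ι nlc⟦ nlcMap ι r t ⟧ nlc⟦ t ⟧ (single tt)
  t[K₁] = NLCSubstitution.substitute-isLex ι r vert r∘ι (λ _ → single≃) (λ _ _ → refl) t

-- d is a junk value, returned off the image of inject≤.
uninject≤ : {m K : ℕ} → Fin m → Fin K → Fin m
uninject≤ {m} d y with toℕ y <? m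
... | yes y<m = fromℕ< y<m
... | no _    = d

uninject≤-inject≤ : {m K : ℕ} (d : Fin m) (m≤K : m ≤ K) (x : Fin m) → uninject≤ d (inject≤ x m≤K) ≡ x
uninject≤-inject≤ {m} d m≤K x with toℕ (inject≤ x m≤K) <? m
... | yes x<m = toℕ-injective (trans (toℕ-fromℕ< x<m) (toℕ-inject≤ x m≤K))
... | no x≮m  = ⊥-elim (x≮m (subst (_< m) (sym (toℕ-inject≤ x m≤K)) (toℕ<n x)))

nlc-substitution : {k₁ k₂ : ℕ} (t₁ : NLCExp k₁) (t₂ : NLCExp k₂) →
                   Σ (NLCExp (k₁ ⊔ k₂)) λ t → IsLex nlc⟦ t ⟧ nlc⟦ t₁ ⟧ nlc⟦ t₂ ⟧
nlc-substitution {k₁} {k₂} t₁ t₂ =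
  substitute t₁ ,
  IsLabelledLex.isLex (substitute-isLex (uninject≤-inject≤ d₁ k₁≤K) block≃ (λ _ _ → refl) t₁)
  where
  k₁≤K = m≤m⊔n k₁ k₂
  k₂≤K = m≤n⊔m k₁ k₂
  d₁ = label nlc⟦ t₁ ⟧ (nlc-vertex t₁)
  d₂ = label nlc⟦ t₂ ⟧ (nlc-vertex t₂)

  block : Fin (k₁ ⊔ k₂) → NLCExp (k₁ ⊔ k₂)
  block a = relab (λ _ → a) (nlcMap (λ x → inject≤ x k₂≤K) (uninject≤ d₂) t₂)
  block≃ : ∀ a → nlc⟦ block a ⟧ ≃ nlc⟦ t₂ ⟧
  block≃ a = ≃-trans (relabel≃ {R = λ _ → a}) (nlcMap-≃ _ _ (uninject≤-inject≤ d₂ k₂≤K) t₂)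

  open NLCSubstitution (λ x → inject≤ x k₁≤K) (uninject≤ d₁) block

-- Width of a lexicographic product

module LexWidth
  (Exp : ℕ → Set)
  (graphOf : {k : ℕ} → Exp k → Graph)
  (sem : {k : ℕ} → Exp k → LabelledGraph (Fin k))
  (graphOf≃sem : {k : ℕ} (t : Exp k) → ⟦ graphOf t ⟧ ≃ sem t)
  -- the lower bound needs a vertex of each factor to cut the other factor out of the product
  (vertex : {k : ℕ} (t : Exp k) → Vertex (sem t))
  (restrict : {k : ℕ} (t : Exp k) (keep : Vertex (sem t) → Bool) →
              ¬ Vertex (sem t ∣ keep) ⊎ Σ (Exp k) (λ t′ → sem t′ ≃ₗ sem t ∣ keep))
  (substitution : {k₁ k₂ : ℕ} (t₁ : Exp k₁) (t₂ : Exp k₂) →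
                  Σ (Exp (k₁ ⊔ k₂)) λ t → IsLex (sem t) (sem t₁) (sem t₂))
  where

  Expressible : ℕ → Graph → Set
  Expressible k G = Σ (Exp k) λ t → graphOf t ≅ G

  HasWidth : Graph → ℕ → Set
  HasWidth G m = Expressible m G × (∀ k → Expressible k G → m ≤ k)

  sem≃ : {k : ℕ} {G : Graph} (t : Exp k) → graphOf t ≅ G → sem t ≃ ⟦ G ⟧
  sem≃ {G = G} t t≅G = ≃-trans (≃-sym (graphOf≃sem t)) (≅⇒≃ {graphOf t} {G} t≅G)

  expressible-vertex : {k : ℕ} {G : Graph} → Expressible k G → Fin (n G)
  expressible-vertex {G = G} (t , t≅G) = to (bijection (sem≃ {G = G} t t≅G)) (vertex t)

  expressible-induced : {k : ℕ} {G H : Graph} (keep : Fin (n G) → Bool) →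
                        ⟦ H ⟧ ≃ ⟦ G ⟧ ∣ keep → Fin (n H) → Expressible k G → Expressible k H
  expressible-induced {k} {G} {H} keep H≃G∣keep x (t , t≅G) =
    from-restriction (restrict t keep′)
    where
    keep′ : Vertex (sem t) → Bool
    keep′ = keep ∘ to (bijection (sem≃ {G = G} t t≅G))
    t∣keep′≃H : sem t ∣ keep′ ≃ ⟦ H ⟧
    t∣keep′≃H = ≃-trans (∣-cong (sem≃ {G = G} t t≅G) keep) (≃-sym H≃G∣keep)
    from-restriction : ¬ Vertex (sem t ∣ keep′) ⊎ Σ (Exp k) (λ t′ → sem t′ ≃ₗ sem t ∣ keep′) →
                       Expressible k H
    from-restriction (inj₁ ∅)        = ⊥-elim (∅ (from (bijection t∣keep′≃H) x))
    from-restriction (inj₂ (t′ , f)) =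
      t′ , ≃⇒≅ {graphOf t′} {H} (≃-trans (graphOf≃sem t′) (≃-trans (iso f) t∣keep′≃H))

  expressible-lex : {k₁ k₂ : ℕ} {G₁ G₂ : Graph} → Irreflexive ⟦ G₁ ⟧ →
                    Expressible k₁ G₁ → Expressible k₂ G₂ → Expressible (k₁ ⊔ k₂) (lex G₁ G₂)
  expressible-lex {G₁ = G₁} {G₂} G₁-irreflexive (t₁ , t₁≅G₁) (t₂ , t₂≅G₂) =
    let t , t-isLex = substitution t₁ t₂ in
    t , ≃⇒≅ {graphOf t} {lex G₁ G₂} (≃-trans (graphOf≃sem t)
          (isLex-unique t-isLex (lex-isLex G₁ G₂ G₁-irreflexive)
                        (sem≃ {G = G₁} t₁ t₁≅G₁) (sem≃ {G = G₂} t₂ t₂≅G₂) _≟_))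

  width-lex : {G₁ G₂ : Graph} {m₁ m₂ : ℕ} → IsSimple G₁ → IsSimple G₂ →
              HasWidth G₁ m₁ → HasWidth G₂ m₂ → HasWidth (lex G₁ G₂) (m₁ ⊔ m₂)
  width-lex {G₁} {G₂} (_ , G₁-irreflexive) (_ , G₂-irreflexive)
            (G₁-expr , G₁-least) (G₂-expr , G₂-least) =
    expressible-lex {G₁ = G₁} {G₂} G₁-irreflexive G₁-expr G₂-expr ,
    λ k lex-expr → ⊔-lub (G₁-least k (G₁-in-lex lex-expr)) (G₂-least k (G₂-in-lex lex-expr))
    where
    u₀ : Fin (n G₁)
    u₀ = expressible-vertex {G = G₁} G₁-expr
    x₀ : Fin (n G₂)
    x₀ = expressible-vertex {G = G₂} G₂-expr
    G₁-in-lex : {k : ℕ} → Expressible k (lex G₁ G₂) → Expressible k G₁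
    G₁-in-lex = expressible-induced {G = lex G₁ G₂} {G₁} _ (lex-section G₁ G₂ G₂-irreflexive x₀) u₀
    G₂-in-lex : {k : ℕ} → Expressible k (lex G₁ G₂) → Expressible k G₂
    G₂-in-lex = expressible-induced {G = lex G₁ G₂} {G₂} _ (lex-fibre G₁ G₂ G₁-irreflexive u₀) x₀

theorem1 : (G₁ G₂ : Graph) → IsSimple G₁ → IsSimple G₂ →
    (∀ m₁ m₂ → IsNLCW G₁ m₁ → IsNLCW G₂ m₂ → IsNLCW (lex G₁ G₂) (m₁ ⊔ m₂)) ×
    (∀ c₁ c₂ → IsCW G₁ c₁ → IsCW G₂ c₂ → IsCW (lex G₁ G₂) (c₁ ⊔ c₂))
theorem1 G₁ G₂ G₁-simple G₂-simple =
  (λ _ _ → NLC.width-lex G₁-simple G₂-simple) , (λ _ _ → CW.width-lex G₁-simple G₂-simple)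
  where
  module NLC = LexWidth NLCExp nlcGraph nlc⟦_⟧ nlcGraph≃ nlc-vertex nlc-restrict nlc-substitution
  module CW  = LexWidth CWExp cwGraph cw⟦_⟧ cwGraph≃ cw-vertex cw-restrict cw-substitution
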